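{- Let $S$ be a finite set and let $\mathcal{A}=\{A_1,\ldots,A_r\}$ be a family of subsets of $S$ satisfying the dragon marriage condition: for every nonempty set $\{i_1,\ldots,i_k\}\subseteq\{1,\ldots,r\}$ we have $|A_{i_1}\cup\cdots\cup A_{i_k}|\geq k+1$. Then for any two systems of distinct representatives $M$ and $M'$ of $\mathcal{A}$, there is a sequence $M=M_1,M_2,\ldots,M_s=M'$ of systems of distinct representatives of $\mathcal{A}$ such that $M_t$ and $M_{t+1}$ differ in exactly one position for each $1\leq t\leq s-1$.
   Context: A system of distinct representatives (SDR) of $\mathcal{A}=\{A_1,\ldots,A_r\}$ is a tuple $(a_1,\ldots,a_r)$ with $a_i\in A_i$ for each $i$ and $a_i\neq a_j$ for $i\neq j$. Two SDRs $(a_1,\ldots,a_r)$ and $(b_1,\ldots,b_r)$ differ in exactly one position if there is exactly one index $i$ with $a_i\neq b_i$. -}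

module Defs where

open import Data.Nat using (ℕ; suc; _≤_; _+_)
open import Data.Bool using (true; false)
open import Data.Fin using (Fin; zero; suc)
open import Data.Fin.Subset using (Subset; _∈_; _∉_; _∪_; ⊥; ∣_∣; Nonempty)
open import Data.Vec using (Vec; []; _∷_)
open import Data.Product using (Σ; ∃; _×_; _,_)
open import Function.Definitions using (Injective)
open import Relation.Binary.PropositionalEquality using (_≡_; _≢_)

-- The ground set S is Fin n; the family A₁,…,A_r is A : Fin r → Subset n.

unionOver : ∀ {n r} → (Fin r → Subset n) → Subset r → Subset n
unionOver {r = 0} A [] = ⊥
unionOver {r = suc r} A (true ∷ I) = A zero ∪ unionOver (λ i → A (suc i)) I
unionOver {r = suc r} A (false ∷ I) = unionOver (λ i → A (suc i)) I

DragonMarriage : ∀ {n r} → (Fin r → Subset n) → Set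
DragonMarriage {n} {r} A =
  (I : Subset r) → Nonempty I → suc ∣ I ∣ ≤ ∣ unionOver A I ∣

IsSDR : ∀ {n r} → (Fin r → Subset n) → (Fin r → Fin n) → Set
IsSDR {n} {r} A a = ((i : Fin r) → a i ∈ A i) × Injective _≡_ _≡_ a

DifferInExactlyOne : ∀ {n r} → (Fin r → Fin n) → (Fin r → Fin n) → Set
DifferInExactlyOne {n} {r} a b =
  Σ (Fin r) λ i → (a i ≢ b i) × ((j : Fin r) → j ≢ i → a j ≡ b j)

-- Single-position changes are reversible, so it suffices to shrink the set D of positions
-- at which M and M′ disagree.  If M′ i is unused by M for some i ∈ D, set position i to it.
-- Otherwise every value of M′ is a value of M.  The dragon condition for D, and then for D
-- enlarged by the positions met so far, yields an alternating path c ∈ D, i₁, …, iₘ ∉ D in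
-- which each position can take over the M-value of the next one and iₘ can take a value y
-- used by neither M nor M′.  Shifting the values along this path, last position first, is a
-- walk from M and equally a walk from M′, and afterwards the two tuples agree at c.
module Submission where

open import Defs
open import Data.Bool using (true; false)
open import Data.Fin using (Fin; zero; suc; fromℕ; inject₁)
open import Data.Fin.Properties using (_≟_; any?; all?)
open import Data.Fin.Subset using (Subset; _∈_; _∉_; _∪_; _⊆_; _⊃_; ⁅_⁆; ∣_∣; Nonempty)
open import Data.Fin.Subset.Properties
  using (_∈?_; nonempty?; x∈p∪q⁺; x∈p∪q⁻; p⊆p∪q; x∈⁅x⁆; x∈⁅y⁆⇒x≡y; ⊥⊆; ∣⊥∣≡0; ∣⁅x⁆∣≡1;
         p⊆q⇒∣p∣≤∣q∣; p⊂q⇒∣p∣<∣q∣)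
open import Data.Fin.Subset.Induction using (⊃-wellFounded)
open import Data.Nat using (ℕ; suc; _≤_; _<_; _+_; z≤n; s≤s)
open import Data.Nat.Induction using (<-wellFounded)
open import Data.Nat.Properties using (≤-trans; ≤-reflexive; +-suc; +-monoʳ-≤; +-mono-≤; n≤1+n; n≮n)
open import Data.Product using (Σ; ∃-syntax; _×_; _,_; proj₁; proj₂)
open import Data.Sum using (_⊎_; inj₁; inj₂; [_,_]; map₁)
open import Data.Vec using ([]; _∷_; tabulate; here; there)
open import Data.Vec.Properties using (lookup∘tabulate; lookup⇒[]=; []=⇒lookup)
open import Data.Vec.Functional using (updateAt)
open import Data.Vec.Functional.Properties using (updateAt-updates; updateAt-minimal; updateAt-id-local)
open import Function using (_∘_; const)
open import Induction.WellFounded using (Acc; acc)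
open import Relation.Binary.Construct.Closure.ReflexiveTransitive using (Star; ε; _◅_; _◅◅_; return; reverse)
open import Relation.Binary.PropositionalEquality using (_≡_; _≢_; _≗_; refl; sym; trans; subst)
open import Relation.Nullary using (yes; no; does; contradiction)
open import Relation.Nullary.Decidable using (¬?; _×-dec_; _→-dec_; dec-true; dec-false; decidable-stable)

∣p∪q∣≤∣p∣+∣q∣ : ∀ {m} (p q : Subset m) → ∣ p ∪ q ∣ ≤ ∣ p ∣ + ∣ q ∣
∣p∪q∣≤∣p∣+∣q∣ []          []          = z≤n
∣p∪q∣≤∣p∣+∣q∣ (true ∷ p)  (true ∷ q)  = s≤s (≤-trans (∣p∪q∣≤∣p∣+∣q∣ p q) (+-monoʳ-≤ ∣ p ∣ (n≤1+n ∣ q ∣)))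
∣p∪q∣≤∣p∣+∣q∣ (true ∷ p)  (false ∷ q) = s≤s (∣p∪q∣≤∣p∣+∣q∣ p q)
∣p∪q∣≤∣p∣+∣q∣ (false ∷ p) (true ∷ q)  = ≤-trans (s≤s (∣p∪q∣≤∣p∣+∣q∣ p q)) (≤-reflexive (sym (+-suc ∣ p ∣ ∣ q ∣)))
∣p∪q∣≤∣p∣+∣q∣ (false ∷ p) (false ∷ q) = ∣p∪q∣≤∣p∣+∣q∣ p q

module _ {n : ℕ} where

  ∈-unionOver : ∀ {r} (A : Fin r → Subset n) {K i} → i ∈ K → A i ⊆ unionOver A K
  ∈-unionOver A {true ∷ K}  {zero}  here      x∈ = x∈p∪q⁺ (inj₁ x∈)
  ∈-unionOver A {true ∷ K}  {suc i} (there h) x∈ = x∈p∪q⁺ (inj₂ (∈-unionOver (A ∘ suc) h x∈))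
  ∈-unionOver A {false ∷ K} {suc i} (there h) x∈ = ∈-unionOver (A ∘ suc) h x∈

  unionOver-least : ∀ {r} (A : Fin r → Subset n) {K B} → (∀ {i} → i ∈ K → A i ⊆ B) → unionOver A K ⊆ B
  unionOver-least A {[]}        h = ⊥⊆
  unionOver-least A {true ∷ K}  h x∈ with x∈p∪q⁻ (A zero) _ x∈
  ... | inj₁ x∈A₀   = h here x∈A₀
  ... | inj₂ x∈rest = unionOver-least (A ∘ suc) (h ∘ there) x∈rest
  unionOver-least A {false ∷ K} h = unionOver-least (A ∘ suc) (h ∘ there)

  image : ∀ {r} → (Fin r → Fin n) → Subset r → Subset n
  image f = unionOver (λ i → ⁅ f i ⁆)

  ∣image∣≤∣K∣ : ∀ {r} (f : Fin r → Fin n) (K : Subset r) → ∣ image f K ∣ ≤ ∣ K ∣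
  ∣image∣≤∣K∣ f []          = ≤-reflexive (∣⊥∣≡0 n)
  ∣image∣≤∣K∣ f (true ∷ K)  = ≤-trans (∣p∪q∣≤∣p∣+∣q∣ ⁅ f zero ⁆ _)
                                      (+-mono-≤ (≤-reflexive (∣⁅x⁆∣≡1 (f zero))) (∣image∣≤∣K∣ (f ∘ suc) K))
  ∣image∣≤∣K∣ f (false ∷ K) = ∣image∣≤∣K∣ (f ∘ suc) K

  unmatched : ∀ {r} {A : Fin r → Subset n} → DragonMarriage A →
              (M : Fin r → Fin n) (K : Subset r) → Nonempty K →
              ∃[ c ] ∃[ w ] c ∈ K × w ∈ A c × (∀ m → m ∈ K → M m ≢ w)
  unmatched {A = A} dragon M K ne
    with any? (λ c → any? λ w → c ∈? K ×-dec w ∈? A c ×-dec all? λ m → m ∈? K →-dec ¬? (M m ≟ w))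
  ... | yes found = found
  ... | no none   =
    contradiction (≤-trans (dragon K ne) (≤-trans (p⊆q⇒∣p∣≤∣q∣ covered) (∣image∣≤∣K∣ M K))) (n≮n ∣ K ∣)
    where
    covered : unionOver A K ⊆ image M K
    covered = unionOver-least A λ {c} c∈K {w} w∈A → matched c∈K w∈A
      where
      matched : ∀ {c w} → c ∈ K → w ∈ A c → w ∈ image M K
      matched {c} {w} c∈K w∈A with any? (λ m → m ∈? K ×-dec M m ≟ w)
      ... | yes (m , m∈K , refl) = ∈-unionOver _ m∈K (x∈⁅x⁆ (M m))
      ... | no  none-m = contradiction (c , w , c∈K , w∈A , λ m m∈K e → none-m (m , m∈K , e)) none

module Reconfiguration {n r : ℕ} (A : Fin r → Subset n) where

  Tuple : Set
  Tuple = Fin r → Fin n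

  private
    variable
      K K′ : Subset r
      c i j k l : Fin r
      y : Fin n
      S T U : Tuple

  Free : Tuple → Fin n → Set
  Free T y = ∀ l → T l ≢ y

  _[_]≔_ : Tuple → Fin r → Fin n → Tuple
  T [ c ]≔ y = updateAt T c (const y)

  ≔-updates : (T [ c ]≔ y) c ≡ y
  ≔-updates {T} {c} = updateAt-updates c T

  ≔-minimal : l ≢ c → (T [ c ]≔ y) l ≡ T l
  ≔-minimal {l} {c} {T} = updateAt-minimal l c T

  ≔-cong : (l ≢ c → S l ≡ T l) → (S [ c ]≔ y) l ≡ (T [ c ]≔ y) l
  ≔-cong {l} {c} h with l ≟ c
  ... | yes refl = trans ≔-updates (sym ≔-updates)
  ... | no  l≢c  = trans (≔-minimal l≢c) (trans (h l≢c) (sym (≔-minimal l≢c)))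

  ∉-≢ : l ∉ K → k ∈ K → l ≢ k
  ∉-≢ l∉K k∈K refl = l∉K k∈K

  j∈K∪⁅j⁆ : j ∈ K ∪ ⁅ j ⁆
  j∈K∪⁅j⁆ {j} = x∈p∪q⁺ (inj₂ (x∈⁅x⁆ j))

  ∉-∪⁅⁆ : l ∉ K → l ≢ j → l ∉ K ∪ ⁅ j ⁆
  ∉-∪⁅⁆ {K = K} {j = j} l∉K l≢j l∈ = [ l∉K , l≢j ∘ x∈⁅y⁆⇒x≡y j ] (x∈p∪q⁻ K ⁅ j ⁆ l∈)

  IsSDR-resp : S ≗ T → IsSDR A S → IsSDR A T
  IsSDR-resp S≗T (mem , inj) =
    (λ i → subst (_∈ A i) (S≗T i) (mem i)) , λ e → inj (trans (S≗T _) (trans e (sym (S≗T _))))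

  DifferInExactlyOne-sym : DifferInExactlyOne S T → DifferInExactlyOne T S
  DifferInExactlyOne-sym (i , S≢T , rest) = i , S≢T ∘ sym , λ j j≢i → sym (rest j j≢i)

  DifferInExactlyOne-respʳ : T ≗ U → DifferInExactlyOne S T → DifferInExactlyOne S U
  DifferInExactlyOne-respʳ T≗U (i , S≢T , rest) =
    i , (λ e → S≢T (trans e (sym (T≗U i)))) , λ j j≢i → trans (rest j j≢i) (T≗U j)

  Adjacent : Tuple → Tuple → Set
  Adjacent S T = IsSDR A S × IsSDR A T × DifferInExactlyOne S T

  -- Without function extensionality a walk must be able to pass between pointwise equal
  -- tuples; such steps disappear when the walk is read as a sequence.
  _∼_ : Tuple → Tuple → Set
  S ∼ T = S ≗ T ⊎ Adjacent S T

  _∼*_ : Tuple → Tuple → Set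
  _∼*_ = Star _∼_

  ∼-sym : S ∼ T → T ∼ S
  ∼-sym (inj₁ S≗T)               = inj₁ (sym ∘ S≗T)
  ∼-sym (inj₂ (S-sdr , T-sdr , d)) = inj₂ (T-sdr , S-sdr , DifferInExactlyOne-sym d)

  ∼*-sym : S ∼* T → T ∼* S
  ∼*-sym = reverse ∼-sym

  ∼*-sdr : IsSDR A S → S ∼* T → IsSDR A T
  ∼*-sdr S-sdr ε                          = S-sdr
  ∼*-sdr S-sdr (inj₁ S≗U ◅ walk)          = ∼*-sdr (IsSDR-resp S≗U S-sdr) walk
  ∼*-sdr S-sdr (inj₂ (_ , U-sdr , _) ◅ walk) = ∼*-sdr U-sdr walk

  ∼*⇒sequence : IsSDR A S → S ∼* T →
    Σ ℕ λ s → Σ (Fin (suc s) → Tuple) λ Ms →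
      ((t : Fin (suc s)) → IsSDR A (Ms t)) × Ms zero ≗ S × Ms (fromℕ s) ≗ T ×
      ((t : Fin s) → DifferInExactlyOne (Ms (inject₁ t)) (Ms (suc t)))
  ∼*⇒sequence {S} S-sdr ε = 0 , const S , const S-sdr , (λ _ → refl) , (λ _ → refl) , λ ()
  ∼*⇒sequence S-sdr (inj₁ S≗U ◅ walk) with ∼*⇒sequence (IsSDR-resp S≗U S-sdr) walk
  ... | s , Ms , sdr , first , last , steps =
    s , Ms , sdr , (λ i → trans (first i) (sym (S≗U i))) , last , steps
  ∼*⇒sequence {S} S-sdr (inj₂ (_ , U-sdr , d) ◅ walk) with ∼*⇒sequence U-sdr walk
  ... | s , Ms , sdr , first , last , steps =
    suc s , (λ { zero → S ; (suc t) → Ms t }) ,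
    (λ { zero → S-sdr ; (suc t) → sdr t }) , (λ _ → refl) , last ,
    λ { zero → DifferInExactlyOne-respʳ (sym ∘ first) d ; (suc t) → steps t }

  update-adjacent : IsSDR A T → y ∈ A c → Free T y → Adjacent T (T [ c ]≔ y)
  update-adjacent {T} {y} {c} T-sdr@(mem , inj) y∈A free =
    T-sdr , (mem′ , inj′) , (c , (λ e → free c (trans e ≔-updates)) , λ l l≢c → sym (≔-minimal l≢c))
    where
    mem′ : ∀ l → (T [ c ]≔ y) l ∈ A l
    mem′ l with l ≟ c
    ... | yes refl = subst (_∈ A l) (sym ≔-updates) y∈A
    ... | no  l≢c  = subst (_∈ A l) (sym (≔-minimal l≢c)) (mem l)
    inj′ : ∀ {l₁ l₂} → (T [ c ]≔ y) l₁ ≡ (T [ c ]≔ y) l₂ → l₁ ≡ l₂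
    inj′ {l₁} {l₂} e with l₁ ≟ c | l₂ ≟ c
    ... | yes refl | yes refl = refl
    ... | yes refl | no l₂≢c  = contradiction (trans (sym (≔-minimal l₂≢c)) (trans (sym e) ≔-updates)) (free l₂)
    ... | no l₁≢c  | yes refl = contradiction (trans (sym (≔-minimal l₁≢c)) (trans e ≔-updates)) (free l₁)
    ... | no l₁≢c  | no l₂≢c  = inj (trans (sym (≔-minimal l₁≢c)) (trans e (≔-minimal l₂≢c)))

  -- Opaque, so that unifying with disagreement S T recovers S and T.
  opaque
    disagreement : Tuple → Tuple → Subset r
    disagreement S T = tabulate λ i → does (¬? (S i ≟ T i))

    ∈-disagreement⁺ : S i ≢ T i → i ∈ disagreement S T
    ∈-disagreement⁺ {S} {i} {T} S≢T =
      lookup⇒[]= i _ (trans (lookup∘tabulate _ i) (dec-true (¬? (S i ≟ T i)) S≢T))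

    ∈-disagreement⁻ : i ∈ disagreement S T → S i ≢ T i
    ∈-disagreement⁻ {i} {S} {T} i∈ S≡T with
      trans (sym ([]=⇒lookup i∈)) (trans (lookup∘tabulate _ i) (dec-false (¬? (S i ≟ T i)) (λ S≢T → S≢T S≡T)))
    ... | ()

  ∉-disagreement : i ∉ disagreement S T → S i ≡ T i
  ∉-disagreement {i} {S} {T} i∉ = decidable-stable (S i ≟ T i) (i∉ ∘ ∈-disagreement⁺)

  disagreement-shrinks : ∀ {S′ T′} → c ∈ disagreement S T →
                         (∀ l → (l ≢ c → S l ≡ T l) → S′ l ≡ T′ l) →
                         ∣ disagreement S′ T′ ∣ < ∣ disagreement S T ∣
  disagreement-shrinks {c} {S} {T} {S′} {T′} c∈ agree = p⊂q⇒∣p∣<∣q∣ (sub , c , c∈ , c∉)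
    where
    sub : disagreement S′ T′ ⊆ disagreement S T
    sub {l} l∈ = ∈-disagreement⁺ λ S≡T → ∈-disagreement⁻ l∈ (agree l (const S≡T))
    c∉ : c ∉ disagreement S′ T′
    c∉ c∈′ = ∈-disagreement⁻ c∈′ (agree c λ c≢c → contradiction refl c≢c)

  AgreeOutside : Subset r → Tuple → Tuple → Set
  AgreeOutside K S T = ∀ {l} → l ∉ K → S l ≡ T l

  AgreeOutside-∪ : AgreeOutside K S T → AgreeOutside (K ∪ K′) S T
  AgreeOutside-∪ agree l∉ = agree (l∉ ∘ p⊆p∪q _)

  module Alternating (M : Tuple) where

    -- A path c = i₀, i₁, …, iₘ in which each iₜ may take the M-value of iₜ₊₁ and iₘ may take
    -- a value y unused by M; the positions i₁, …, iₘ are distinct and lie outside K.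
    data Path (K : Subset r) (c : Fin r) : Set where
      exit : y ∈ A c → Free M y → Path K c
      hop  : j ∉ K → M j ∈ A c → Path (K ∪ ⁅ j ⁆) j → Path K c

    weaken : K ⊆ K′ → Path K′ c → Path K c
    weaken K⊆K′ (exit y∈A y-free)  = exit y∈A y-free
    weaken K⊆K′ (hop j∉K′ Mj∈A p) =
      hop (j∉K′ ∘ K⊆K′) Mj∈A (weaken (λ l∈ → x∈p∪q⁺ (map₁ K⊆K′ (x∈p∪q⁻ _ _ l∈))) p)

    shift : Path K c → Tuple → Tuple
    shift {c = c} (exit {y = y} _ _) T = T [ c ]≔ y
    shift {c = c} (hop {j = j} _ _ p) T = shift p T [ c ]≔ M j

    shift-cong : (p : Path K c) → (l ≢ c → S l ≡ T l) → shift p S l ≡ shift p T l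
    shift-cong (exit _ _)  h = ≔-cong h
    shift-cong (hop _ _ p) h = ≔-cong λ l≢c → shift-cong p λ _ → h l≢c

    shift-keeps : (p : Path K c) → l ∈ K → l ≢ c → shift p T l ≡ T l
    shift-keeps (exit _ _)      l∈K l≢c = ≔-minimal l≢c
    shift-keeps (hop j∉K _ p)   l∈K l≢c =
      trans (≔-minimal l≢c) (shift-keeps p (p⊆p∪q _ l∈K) (λ l≡j → ∉-≢ j∉K l∈K (sym l≡j)))

    module _ {T : Tuple} (T-sdr : IsSDR A T) (free-transfer : ∀ {y} → Free M y → Free T y) where

      private
        inj : ∀ {l₁ l₂} → T l₁ ≡ T l₂ → l₁ ≡ l₂
        inj = proj₂ T-sdr

      shift-avoids : c ∈ K → AgreeOutside K T M → (p : Path K c) →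
                     l ∉ K ⊎ l ≡ c → k ∈ K → shift p T l ≢ T k
      shift-avoids c∈K agree (exit y∈A y-free) (inj₂ refl) k∈K e =
        free-transfer y-free _ (trans (sym e) ≔-updates)
      shift-avoids c∈K agree (exit _ _) (inj₁ l∉K) k∈K e =
        ∉-≢ l∉K k∈K (inj (trans (sym (≔-minimal (∉-≢ l∉K c∈K))) e))
      shift-avoids c∈K agree (hop j∉K _ _) (inj₂ refl) k∈K e =
        ∉-≢ j∉K k∈K (inj (trans (agree j∉K) (trans (sym ≔-updates) e)))
      shift-avoids {l = l} c∈K agree (hop {j = j} j∉K _ p) (inj₁ l∉K) k∈K e =
        shift-avoids j∈K∪⁅j⁆ (AgreeOutside-∪ agree) p off-path (p⊆p∪q _ k∈K)
          (trans (sym (≔-minimal (∉-≢ l∉K c∈K))) e)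
        where
        off-path : l ∉ _ ∪ ⁅ j ⁆ ⊎ l ≡ j
        off-path with l ≟ j
        ... | yes l≡j = inj₂ l≡j
        ... | no  l≢j = inj₁ (∉-∪⁅⁆ l∉K l≢j)

      shift-frees-start : c ∈ K → AgreeOutside K T M → (p : Path K c) → Free (shift p T) (T c)
      shift-frees-start {c} {K} c∈K agree p l with l ≟ c | l ∈? K
      ... | yes l≡c | _       = shift-avoids c∈K agree p (inj₂ l≡c) c∈K
      ... | no  _   | no  l∉K = shift-avoids c∈K agree p (inj₁ l∉K) c∈K
      ... | no  l≢c | yes l∈K = λ e → l≢c (inj (trans (sym (shift-keeps p l∈K l≢c)) e))

      shift-reachable : c ∈ K → AgreeOutside K T M → (p : Path K c) → T ∼* shift p T
      shift-reachable c∈K agree (exit y∈A y-free) =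
        return (inj₂ (update-adjacent T-sdr y∈A (free-transfer y-free)))
      shift-reachable c∈K agree (hop {j = j} j∉K Mj∈A p) =
        walk ◅◅ return (inj₂ (update-adjacent (∼*-sdr T-sdr walk) Mj∈A Mj-free))
        where
        walk : T ∼* shift p T
        walk = shift-reachable j∈K∪⁅j⁆ (AgreeOutside-∪ agree) p
        Mj-free : Free (shift p T) (M j)
        Mj-free = subst (Free (shift p T)) (agree j∉K) (shift-frees-start j∈K∪⁅j⁆ (AgreeOutside-∪ agree) p)

    path-from : DragonMarriage A → Nonempty K → Acc _⊃_ K → ∃[ c ] c ∈ K × Path K c
    path-from {K} dragon ne (acc rec) with unmatched dragon M K ne
    ... | c , w , c∈K , w∈A , w∉MK with any? (λ j → M j ≟ w)
    ...   | no  w-free = c , c∈K , exit w∈A λ l e → w-free (l , e)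
    ...   | yes (j , refl)
            with path-from dragon (proj₁ ne , p⊆p∪q _ (proj₂ ne))
                   (rec (p⊆p∪q _ , j , j∈K∪⁅j⁆ , λ j∈K → w∉MK j j∈K refl))
    ...     | c′ , c′∈ , p with x∈p∪q⁻ K ⁅ j ⁆ c′∈
    ...       | inj₁ c′∈K = c′ , c′∈K , weaken (p⊆p∪q _) p
    ...       | inj₂ c′∈j with x∈⁅y⁆⇒x≡y j c′∈j
    ...         | refl = c , c∈K , hop (λ j∈K → w∉MK j j∈K refl) w∈A p

  ConnectedBelow : Tuple → Tuple → Set
  ConnectedBelow S T = ∀ {S′ T′} → IsSDR A S′ → IsSDR A T′ →
                       ∣ disagreement S′ T′ ∣ < ∣ disagreement S T ∣ → S′ ∼* T′

  connected-by-update : IsSDR A S → IsSDR A T → ConnectedBelow S T →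
                        i ∈ disagreement S T → Free S (T i) → S ∼* T
  connected-by-update {S} {T} {i} S-sdr T-sdr below i∈D Ti-free =
    inj₂ adj ◅ below (proj₁ (proj₂ adj)) T-sdr (disagreement-shrinks i∈D agree)
    where
    adj : Adjacent S (S [ i ]≔ T i)
    adj = update-adjacent S-sdr (proj₁ T-sdr i) Ti-free
    agree : ∀ l → (l ≢ i → S l ≡ T l) → (S [ i ]≔ T i) l ≡ T l
    agree l h = trans (≔-cong h) (updateAt-id-local i T refl l)

  connected-by-shift : DragonMarriage A → IsSDR A S → IsSDR A T → ConnectedBelow S T →
                       Nonempty (disagreement S T) → (∀ {y} → Free S y → Free T y) → S ∼* T
  connected-by-shift {S} {T} dragon S-sdr T-sdr below ne free-transfer
    with Alternating.path-from S dragon ne (⊃-wellFounded _)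
  ... | c , c∈D , p = S∼*N ◅◅ below N-sdr N′-sdr shrinks ◅◅ ∼*-sym T∼*N′
    where
    open Alternating S
    S∼*N : S ∼* shift p S
    S∼*N = shift-reachable S-sdr (λ y-free → y-free) c∈D (λ _ → refl) p
    T∼*N′ : T ∼* shift p T
    T∼*N′ = shift-reachable T-sdr free-transfer c∈D (sym ∘ ∉-disagreement) p
    N-sdr : IsSDR A (shift p S)
    N-sdr = ∼*-sdr S-sdr S∼*N
    N′-sdr : IsSDR A (shift p T)
    N′-sdr = ∼*-sdr T-sdr T∼*N′
    shrinks : ∣ disagreement (shift p S) (shift p T) ∣ < ∣ disagreement S T ∣
    shrinks = disagreement-shrinks c∈D λ l h → shift-cong p h

  connected-step : DragonMarriage A → IsSDR A S → IsSDR A T → ConnectedBelow S T → S ∼* T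
  connected-step {S} {T} dragon S-sdr T-sdr below with nonempty? (disagreement S T)
  ... | no empty = return (inj₁ λ i → ∉-disagreement λ i∈ → empty (i , i∈))
  ... | yes ne with any? (λ i → i ∈? disagreement S T ×-dec all? λ l → ¬? (S l ≟ T i))
  ...   | yes (i , i∈D , Ti-free) = connected-by-update S-sdr T-sdr below i∈D Ti-free
  ...   | no none-free = connected-by-shift dragon S-sdr T-sdr below ne free-transfer
    where
    free-transfer : Free S y → Free T y
    free-transfer y-free l Tl≡y with l ∈? disagreement S T
    ... | yes l∈D = none-free (l , l∈D , λ m Sm≡Tl → y-free m (trans Sm≡Tl Tl≡y))
    ... | no  l∉D = y-free l (trans (∉-disagreement l∉D) Tl≡y)

  connected : DragonMarriage A → IsSDR A S → IsSDR A T → Acc _<_ ∣ disagreement S T ∣ → S ∼* T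
  connected dragon S-sdr T-sdr (acc rec) =
    connected-step dragon S-sdr T-sdr λ S′-sdr T′-sdr lt → connected dragon S′-sdr T′-sdr (rec lt)

lemma5p2 : (n r : ℕ) (A : Fin r → Subset n) → DragonMarriage A →
    (M M′ : Fin r → Fin n) → IsSDR A M → IsSDR A M′ →
    Σ ℕ λ s → Σ (Fin (suc s) → Fin r → Fin n) λ Ms →
      ((t : Fin (suc s)) → IsSDR A (Ms t)) ×
      ((i : Fin r) → Ms zero i ≡ M i) ×
      ((i : Fin r) → Ms (fromℕ s) i ≡ M′ i) ×
      ((t : Fin s) → DifferInExactlyOne (Ms (inject₁ t)) (Ms (suc t)))
lemma5p2 n r A dragon M M′ M-sdr M′-sdr =
  ∼*⇒sequence M-sdr (connected dragon M-sdr M′-sdr (<-wellFounded _))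
  where open Reconfiguration A
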